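{- Let $\boldsymbol{x}_0,\boldsymbol{x}_1,\ldots\in[0,1)^{\mathbb{N}}$ be the points of a digital sequence over $\mathbb{F}_2$ with generating matrices $C_j=(c_{j,k,\ell})_{k,\ell\in\mathbb{N}}$, $j\in\mathbb{N}$, satisfying $c_{j,k,\ell}=0$ for all $k>2\ell$. Let $m\ge0$ and $\beta\ge0$ be integers. Then the point set $\boldsymbol{x}_{\beta2^m},\boldsymbol{x}_{\beta2^m+1},\ldots,\boldsymbol{x}_{\beta2^m+2^m-1}$ is a digitally shifted digital net with generating matrices $C_j^{2m\times m}$, $j\in\mathbb{N}$, shifted by a digital shift vector $\boldsymbol{\sigma}=(\sigma_1,\sigma_2,\ldots)$ all of whose coordinates $\sigma_j$ are dyadic rationals.
   Context: Identify $0,1\in\mathbb{F}_2$ with integers $0,1$. Digital sequence: for $n\in\mathbb{N}_0$ with $n=\sum_{i\ge0}n_i2^i$, $x_{j,n,k}=\sum_{\ell\ge1}n_{\ell-1}c_{j,k,\ell}\in\mathbb{F}_2$, $x_{j,n}=\sum_{k\ge1}x_{j,n,k}2^{ -k}$ and $\boldsymbol{x}_n=(x_{1,n},x_{2,n},\ldots)$. For a matrix $C_j$, $C_j^{u\times v}=(c_{j,k,\ell})_{1\le k\le u,1\le\ell\le v}$ is its upper-left $u\times v$ submatrix. Digital net with matrices $D_j\in\mathbb{F}_2^{2m\times m}$, $j\in\mathbb{N}$: for $n\in\{0,\ldots,2^m-1\}$ with digits $n_0,\ldots,n_{m-1}$, $x_{j,n,k}=\sum_{\ell=1}^m n_{\ell-1}d_{j,k,\ell}$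 for $1\le k\le 2m$, $x_{j,n}=\sum_{k=1}^{2m}x_{j,n,k}2^{ -k}$, and the net is $\{\boldsymbol{x}_n:0\le n<2^m\}$. For $x=\sum_i x_i2^{ -i}$, $y=\sum_iy_i2^{ -i}$ (finite expansions for dyadic rationals), $x\oplus y=\sum_i((x_i+y_i)\bmod 2)2^{ -i}$, applied componentwise to vectors. The digitally shifted net by $\boldsymbol{\sigma}$ consists of the points $\boldsymbol{x}_n\oplus\boldsymbol{\sigma}$, $0\le n<2^m$. -}

module Defs where

open import Data.Bool using (Bool; true; false; _xor_; _∧_; if_then_else_)
open import Data.Nat using (ℕ; zero; suc; _*_; _∸_; _≤_; _<_; _≤ᵇ_; _/_; _%_; _≡ᵇ_)
open import Data.Product using (Σ; ∃)
open import Relation.Binary.PropositionalEquality using (_≡_)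

-- A (generating) matrix family over F₂ = Bool (false = 0, true = 1, xor = +, ∧ = ·):
-- Mats j k ℓ = c_{j,k,ℓ}. Indices j, k, ℓ are 1-based as in the paper;
-- entries with a zero index are junk and never used.
Mats : Set
Mats = ℕ → ℕ → ℕ → Bool

-- A point in [0,1)^ℕ with finite (dyadic) binary expansions in every coordinate,
-- given by its digit array: P j k = k-th binary digit (k ≥ 1) of coordinate j (j ≥ 1).
Point : Set
Point = ℕ → ℕ → Bool

digit : ℕ → ℕ → Bool
digit n zero    = n % 2 ≡ᵇ 1
digit n (suc i) = digit (n / 2) i

xsum : ℕ → (ℕ → Bool) → Bool
xsum zero    f = false
xsum (suc L) f = xsum L f xor f (suc L)

-- Digital sequence: x_{j,n,k} = Σ_{ℓ≥1} n_{ℓ-1} c_{j,k,ℓ}.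
-- Since n < 2^n, n_{ℓ-1} = 0 for ℓ > n, so the sum over ℓ = 1..n is the full sum.
seqPoint : Mats → ℕ → Point
seqPoint C n j k = xsum n (λ ℓ → digit n (ℓ ∸ 1) ∧ C j k ℓ)

-- Digital net with matrices D_j = C_j^{2m×m}: for 1 ≤ k ≤ 2m,
-- x_{j,n,k} = Σ_{ℓ=1}^{m} n_{ℓ-1} c_{j,k,ℓ}; digits k > 2m are 0.
netPoint : Mats → ℕ → ℕ → Point
netPoint C m n j k = if k ≤ᵇ 2 * m then xsum m (λ ℓ → digit n (ℓ ∸ 1) ∧ C j k ℓ) else false

_⊕_ : Point → Point → Point
(P ⊕ Q) j k = P j k xor Q j k

SamePoint : Point → Point → Set
SamePoint P Q = ∀ j k → 1 ≤ j → 1 ≤ k → P j k ≡ Q j k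

-- A digit sequence represents a dyadic rational: only finitely many digits are 1.
Dyadic : (ℕ → Bool) → Set
Dyadic s = Σ ℕ λ K → ∀ k → K < k → s k ≡ false

{-# OPTIONS --safe #-}
module Submission where

-- The digits of β 2^m + n (n < 2^m) are those of β 2^m xored with those of n, and a digital
-- sequence is F₂-linear in the digits of its index, so x_{β2^m + n} = x_n ⊕ x_{β2^m}.
-- Since n has at most m digits, x_n only uses the first m columns of each C_j, and by the
-- band condition c_{j,k,ℓ} = 0 for k > 2ℓ it only uses the first 2m rows: x_n is the n-th
-- point of the net with matrices C_j^{2m×m}. The shift σ = x_{β2^m} is dyadic for the same
-- reason: its index has at most β 2^m digits, so its digits vanish beyond position 2β 2^m.

open import Defs
open import Data.Bool using (Bool; false; true; _xor_; _∧_; T)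
open import Data.Bool.Properties
  using (xor-∧-commutativeRing; xor-comm; xor-identityʳ; ∧-distribʳ-xor; ∧-zeroʳ)
open import Data.Nat
  using (ℕ; zero; suc; _+_; _*_; _^_; _∸_; _/_; _%_; _≡ᵇ_; _≤_; _<_; _≤ᵇ_; z≤n; s≤s)
open import Data.Nat.Properties
open import Data.Nat.DivMod using ([m+kn]%n≡m%n; m*n%n≡0; m*n/n≡m; +-distrib-/-∣ˡ; m<n*o⇒m/o<n)
open import Data.Nat.Divisibility using (divides-refl)
open import Data.Fin using (Fin; toℕ)
open import Data.Fin.Properties using (toℕ<n)
open import Data.Product using (Σ; _×_; _,_)
open import Data.Sum using (inj₁; inj₂)
open import Function.Bundles using (_↔_; Inverse)
open import Function.Construct.Identity using (↔-id)
open import Relation.Binary.PropositionalEquality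
open import Algebra.Bundles using (CommutativeRing)
open import Algebra.Properties.CommutativeSemigroup
  (CommutativeRing.+-commutativeSemigroup xor-∧-commutativeRing) using (interchange)

xsum-cong : ∀ L {f g : ℕ → Bool} → (∀ ℓ → f ℓ ≡ g ℓ) → xsum L f ≡ xsum L g
xsum-cong zero    f≡g = refl
xsum-cong (suc L) f≡g = cong₂ _xor_ (xsum-cong L f≡g) (f≡g (suc L))

xsum-xor : ∀ L (f g : ℕ → Bool) → xsum L (λ ℓ → f ℓ xor g ℓ) ≡ xsum L f xor xsum L g
xsum-xor zero    f g = refl
xsum-xor (suc L) f g = begin
  xsum L (λ ℓ → f ℓ xor g ℓ) xor (f (suc L) xor g (suc L))
    ≡⟨ cong (_xor (f (suc L) xor g (suc L))) (xsum-xor L f g) ⟩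
  (xsum L f xor xsum L g) xor (f (suc L) xor g (suc L))
    ≡⟨ interchange (xsum L f) (xsum L g) (f (suc L)) (g (suc L)) ⟩
  (xsum L f xor f (suc L)) xor (xsum L g xor g (suc L))
    ∎
  where open ≡-Reasoning

xsum-false : ∀ L {f : ℕ → Bool} → (∀ ℓ → 1 ≤ ℓ → ℓ ≤ L → f ℓ ≡ false) → xsum L f ≡ false
xsum-false zero    f≡false = refl
xsum-false (suc L) f≡false = cong₂ _xor_
  (xsum-false L (λ ℓ 1≤ℓ ℓ≤L → f≡false ℓ 1≤ℓ (m≤n⇒m≤1+n ℓ≤L)))
  (f≡false (suc L) (s≤s z≤n) ≤-refl)

xsum-extend : ∀ {a} b {f : ℕ → Bool} → (∀ ℓ → a < ℓ → f ℓ ≡ false) → a ≤ b →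
              xsum b f ≡ xsum a f
xsum-extend zero    f≡false z≤n = refl
xsum-extend {a} (suc b) {f} f≡false a≤1+b with m≤n⇒m<n∨m≡n a≤1+b
... | inj₂ refl      = refl
... | inj₁ (s≤s a≤b) = begin
  xsum b f xor f (suc b) ≡⟨ cong (xsum b f xor_) (f≡false (suc b) (s≤s a≤b)) ⟩
  xsum b f xor false     ≡⟨ xor-identityʳ (xsum b f) ⟩
  xsum b f               ≡⟨ xsum-extend b f≡false a≤b ⟩
  xsum a f               ∎
  where open ≡-Reasoning

n<2^n : ∀ n → n < 2 ^ n
n<2^n zero    = s≤s z≤n
n<2^n (suc n) = begin-strict
  suc n           ≡⟨ +-comm 1 n ⟩
  n + 1           <⟨ +-monoˡ-< 1 (n<2^n n) ⟩
  2 ^ n + 1       ≤⟨ +-monoʳ-≤ (2 ^ n) (m^n>0 2 n) ⟩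
  2 ^ n + 2 ^ n   ≡⟨ cong (2 ^ n +_) (sym (+-identityʳ (2 ^ n))) ⟩
  2 ^ suc n       ∎
  where open ≤-Reasoning

≤⇒<2^ : ∀ {n a} → n ≤ a → n < 2 ^ a
≤⇒<2^ {a = a} n≤a = ≤-<-trans n≤a (n<2^n a)

<2^⇒digit≡false : ∀ x i → x < 2 ^ i → digit x i ≡ false
<2^⇒digit≡false zero    zero    _         = refl
<2^⇒digit≡false (suc x) zero    (s≤s ())
<2^⇒digit≡false x       (suc i) x<2^[1+i] =
  <2^⇒digit≡false (x / 2) i (m<n*o⇒m/o<n (subst (x <_) (*-comm 2 (2 ^ i)) x<2^[1+i]))

digit-*2+ : ∀ a b i → digit (a * 2 + b) (suc i) ≡ digit (a + b / 2) i
digit-*2+ a b i = cong (λ x → digit x i) (begin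
  (a * 2 + b) / 2   ≡⟨ +-distrib-/-∣ˡ b (divides-refl a) ⟩
  a * 2 / 2 + b / 2 ≡⟨ cong (_+ b / 2) (m*n/n≡m a 2) ⟩
  a + b / 2         ∎)
  where open ≡-Reasoning

digit-*2-zero : ∀ a → digit (a * 2) zero ≡ false
digit-*2-zero a = cong (_≡ᵇ 1) (m*n%n≡0 a 2)

digit-*2+-zero : ∀ a b → digit (a * 2 + b) zero ≡ digit b zero
digit-*2+-zero a b = cong (_≡ᵇ 1) (begin
  (a * 2 + b) % 2 ≡⟨ cong (_% 2) (+-comm (a * 2) b) ⟩
  (b + a * 2) % 2 ≡⟨ [m+kn]%n≡m%n b a 2 ⟩
  b % 2           ∎)
  where open ≡-Reasoning

digit-*2^+ : ∀ q m {n} → n < 2 ^ m → ∀ i →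
             digit (q * 2 ^ m + n) i ≡ digit (q * 2 ^ m) i xor digit n i
digit-*2^+ q zero    {zero}  _ i
  rewrite +-identityʳ (q * 1) | <2^⇒digit≡false 0 i (m^n>0 2 i) = sym (xor-identityʳ _)
digit-*2^+ q zero    {suc n} (s≤s ())
digit-*2^+ q (suc m) {n}     n<2^[1+m] i
  -- normalise q * 2 ^ (1 + m) to (q * 2 ^ m) * 2, exposing the lowest digit
  rewrite sym (*-assoc q 2 (2 ^ m)) | *-comm q 2 | *-assoc 2 q (2 ^ m) | *-comm 2 (q * 2 ^ m)
  with i
... | zero  = begin
  digit (q * 2 ^ m * 2 + n) zero
    ≡⟨ digit-*2+-zero (q * 2 ^ m) n ⟩
  digit n zero
    ≡⟨ cong (_xor digit n zero) (digit-*2-zero (q * 2 ^ m)) ⟨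
  digit (q * 2 ^ m * 2) zero xor digit n zero
    ∎
  where open ≡-Reasoning
... | suc i = begin
  digit (q * 2 ^ m * 2 + n) (suc i)
    ≡⟨ digit-*2+ (q * 2 ^ m) n i ⟩
  digit (q * 2 ^ m + n / 2) i
    ≡⟨ digit-*2^+ q m (m<n*o⇒m/o<n (subst (n <_) (*-comm 2 (2 ^ m)) n<2^[1+m])) i ⟩
  digit (q * 2 ^ m) i xor digit (n / 2) i
    ≡⟨ cong (λ x → digit x i xor digit (n / 2) i) (m*n/n≡m (q * 2 ^ m) 2) ⟨
  digit (q * 2 ^ m * 2) (suc i) xor digit n (suc i)
    ∎
  where open ≡-Reasoning

dotRow : Mats → ℕ → ℕ → ℕ → ℕ → Bool
dotRow C L n j k = xsum L (λ ℓ → digit n (ℓ ∸ 1) ∧ C j k ℓ)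

dotRow-linear : ∀ C L {x y z} → (∀ i → digit z i ≡ digit x i xor digit y i) → ∀ j k →
                dotRow C L z j k ≡ dotRow C L x j k xor dotRow C L y j k
dotRow-linear C L {x} {y} z-digits j k = trans
  (xsum-cong L λ ℓ → trans (cong (_∧ C j k ℓ) (z-digits (ℓ ∸ 1)))
                           (∧-distribʳ-xor (C j k ℓ) (digit x (ℓ ∸ 1)) (digit y (ℓ ∸ 1))))
  (xsum-xor L _ _)

dotRow-extend : ∀ C {a} b {n} → n < 2 ^ a → a ≤ b → ∀ j k →
                dotRow C b n j k ≡ dotRow C a n j k
dotRow-extend C b {n} n<2^a a≤b j k = xsum-extend b vanishes-beyond a≤b
  where
  vanishes-beyond : ∀ ℓ → _ < ℓ → digit n (ℓ ∸ 1) ∧ C j k ℓ ≡ false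
  vanishes-beyond (suc ℓ) (s≤s a≤ℓ)
    rewrite <2^⇒digit≡false n ℓ (<-≤-trans n<2^a (^-monoʳ-≤ 2 a≤ℓ)) = refl

dotRow-stable : ∀ C a b {n} → n < 2 ^ a → n < 2 ^ b → ∀ j k →
                dotRow C a n j k ≡ dotRow C b n j k
dotRow-stable C a b n<2^a n<2^b j k with ≤-total a b
... | inj₁ a≤b = sym (dotRow-extend C b n<2^a a≤b j k)
... | inj₂ b≤a = dotRow-extend C a n<2^b b≤a j k

BandedBelow : Mats → Set
BandedBelow C = ∀ j k ℓ → 1 ≤ j → 1 ≤ ℓ → 2 * ℓ < k → C j k ℓ ≡ false

dotRow-banded : ∀ {C} → BandedBelow C → ∀ L n {j k} → 1 ≤ j → 2 * L < k →
                dotRow C L n j k ≡ false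
dotRow-banded banded L n {j} {k} 1≤j 2L<k = xsum-false L λ ℓ 1≤ℓ ℓ≤L →
  trans (cong (digit n (ℓ ∸ 1) ∧_) (banded j k ℓ 1≤j 1≤ℓ (≤-<-trans (*-monoʳ-≤ 2 ℓ≤L) 2L<k)))
        (∧-zeroʳ _)

netPoint≡dotRow : ∀ {C} → BandedBelow C → ∀ m n {j} k → 1 ≤ j →
                  netPoint C m n j k ≡ dotRow C m n j k
netPoint≡dotRow banded m n k 1≤j with k ≤ᵇ 2 * m in k≤ᵇ2m
... | true  = refl
... | false = sym (dotRow-banded banded m n 1≤j (≰⇒> λ k≤2m → subst T k≤ᵇ2m (≤⇒≤ᵇ k≤2m)))

seqPoint-block : ∀ {C} → BandedBelow C → ∀ m β {n} → n < 2 ^ m →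
                 SamePoint (seqPoint C (β * 2 ^ m + n)) (netPoint C m n ⊕ seqPoint C (β * 2 ^ m))
seqPoint-block {C} banded m β {n} n<2^m j k 1≤j _ = begin
  dotRow C N N j k
    ≡⟨ dotRow-linear C N (digit-*2^+ β m n<2^m) j k ⟩
  dotRow C N B j k xor dotRow C N n j k
    ≡⟨ cong₂ _xor_ (dotRow-stable C N B (≤⇒<2^ (m≤m+n B n)) (n<2^n B) j k)
                   (dotRow-stable C N m (≤⇒<2^ (m≤n+m n B)) n<2^m j k) ⟩
  dotRow C B B j k xor dotRow C m n j k
    ≡⟨ xor-comm (dotRow C B B j k) (dotRow C m n j k) ⟩
  dotRow C m n j k xor dotRow C B B j k
    ≡⟨ cong (_xor dotRow C B B j k) (netPoint≡dotRow banded m n k 1≤j) ⟨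
  netPoint C m n j k xor dotRow C B B j k
    ∎
  where
  open ≡-Reasoning
  B = β * 2 ^ m
  N = B + n

seqPoint-dyadic : ∀ {C} → BandedBelow C → ∀ n j → 1 ≤ j → Dyadic (seqPoint C n j)
seqPoint-dyadic banded n j 1≤j = 2 * n , λ k 2n<k → dotRow-banded banded n n 1≤j 2n<k

lemma1 : (C : Mats)
    → (∀ j k ℓ → 1 ≤ j → 1 ≤ ℓ → 2 * ℓ < k → C j k ℓ ≡ false)
    → (m β : ℕ)
    → Σ Point λ σ → (∀ j → 1 ≤ j → Dyadic (σ j))
      × Σ (Fin (2 ^ m) ↔ Fin (2 ^ m)) λ π →
          ∀ (n : Fin (2 ^ m)) →
            SamePoint (seqPoint C (β * 2 ^ m + toℕ n))
                      (netPoint C m (toℕ (Inverse.to π n)) ⊕ σ)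
lemma1 C banded m β =
  seqPoint C (β * 2 ^ m) , seqPoint-dyadic banded (β * 2 ^ m) ,
  ↔-id _ , λ n → seqPoint-block banded m β (toℕ<n n)
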